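{- For $\lhd\in\mathrm{WOIP}$ let $G_\lhd=\sum F_\prec\in\mathbb{K}\mathrm{IPos}$, the sum over all $\prec\in\mathrm{IPos}$ with $\mathrm{d}(\prec)=\lhd$. The linear span $\mathbb{K}\mathrm{WOIP}^{\mathrm{sub}}$ of $\{G_\lhd:\lhd\in\mathrm{WOIP}\}$ is stable under the product and the coproduct of $\mathbb{K}\mathrm{IPos}$, hence is a Hopf subalgebra of $(\mathbb{K}\mathrm{IPos},\cdot,\Delta)$. The same holds with $(\mathrm{WOIP},\mathrm{d})$ replaced by $(\mathrm{IWOIP},\mathrm{d}_I)$ and by $(\mathrm{DWOIP},\mathrm{d}_D)$.
   Context: For $n\ge0$ let $[n]=\{1,\dots,n\}$. An integer poset of size $n$ is a reflexive antisymmetric transitive relation $\prec$ on $[n]$; $\mathrm{IPos}=\bigsqcup_n\mathrm{IPos}_n$; write $a\succ b$ for $b\prec a$. $\mathrm{IWOIP}_n$: posets with ($a\prec c\Rightarrow a\prec b$ or $b\prec c$) for all $a<b<c$; $\mathrm{DWOIP}_n$: posets with ($a\succ c\Rightarrow a\succ b$ or $b\succ c$) for all $a<b<c$; $\mathrm{WOIP}_n=\mathrm{IWOIP}_n\cap\mathrm{DWOIP}_n$; unions over $n$ are $\mathrm{IWOIP},\mathrm{DWOIP},\mathrm{WOIP}$. For a poset $\prec$ define $\mathrm{d}_I(\prec)=\prec\setminus\{(a,c): a<c,\ \exists\,a<b_1<\dots<b_k<c$ with $a\not\prec b_1\not\prec b_2\not\prec\dots\not\prec b_k\not\prec c\}$,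 $\mathrm{d}_D(\prec)=\prec\setminus\{(c,a):a<c,\ \exists\,a<b_1<\dots<b_k<c$ with $a\not\succ b_1\not\succ\dots\not\succ b_k\not\succ c\}$ (here $k\ge1$), and $\mathrm{d}(\prec)=\mathrm{d}_I(\mathrm{d}_D(\prec))=\mathrm{d}_D(\mathrm{d}_I(\prec))$. It is known that $\mathrm{d}_I,\mathrm{d}_D,\mathrm{d}$ are projections from $\mathrm{IPos}$ onto $\mathrm{IWOIP},\mathrm{DWOIP},\mathrm{WOIP}$ respectively. For $R$ of size $n$ and $X=\{x_1<\dots<x_k\}\subseteq[n]$, $R_X=\{(i,j)\in[k]^2:(x_i,x_j)\in R\}$. For $S$ of size $n$, $m\ge0$: $\overline{S}=\{(m+i,m+j):(i,j)\in S\}$, $\overline{[n]}=\{m+1,\dots,m+n\}$; for $R$ of size $m$, $\mathrm{Sh}(R,S)$ is the set of all $R\cup\overline{S}\cup I\cup D$ with $I\subseteq[m]\times\overline{[n]}$, $D\subseteq\overline{[n]}\times[m]$. A total cut of $T$ on $[p]$ is a partition $[p]=X\sqcup Y$ with $(x,y)\in T$, $(y,x)\notin T$ for all $x\in X,y\in Y$; $R\star S$ is the set of relations $T$ on $[m+n]$ admitting a total cut $(X,Y)$ with $T_X=R$, $T_Y=S$. $(\mathbb{K}\mathrm{IPos},\cdot,\Delta)$ is the Hopf algebra with basis $(F_\prec)_{\prec\in\mathrm{IPos}}$, product $F_\prec\cdot F_\lhd=\sum_{T\in\mathrm{Sh}(\prec,\lhd)\cap\mathrm{IPos}}F_T$,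 coproduct $\Delta(F_T)=\sum_{(R,S):T\in R\star S}F_R\otimes F_S$. -}

module Defs where

open import Level using (Level; _⊔_) renaming (suc to lsuc)
open import Data.Bool using (Bool; true; false; _∧_; _∨_; not; if_then_else_)
open import Data.Nat using (ℕ; zero; suc; _+_)
open import Data.Fin using (Fin; _<_; _↑ˡ_; _↑ʳ_)
open import Data.Fin.Properties using (_<?_; _≟_)
open import Data.List using (List; []; _∷_; map; concatMap; allFin; filter; length)
open import Data.Bool.ListAction using (any; all)
open import Data.Vec.Functional using (Vector) renaming (_∷_ to _∷ᶠ_)
open import Data.Product using (Σ; _×_; _,_)
open import Relation.Nullary using (¬_)
open import Relation.Nullary.Decidable using (⌊_⌋)
open import Relation.Binary.PropositionalEquality using (_≡_)
open import Algebra.Bundles using (CommutativeRing)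

record Field (c ℓ : Level) : Set (lsuc (c ⊔ ℓ)) where
  field
    commutativeRing : CommutativeRing c ℓ
  open CommutativeRing commutativeRing public
  field
    0≉1     : ¬ (0# ≈ 1#)
    inverse : ∀ x → ¬ (x ≈ 0#) → Σ Carrier λ y → (x * y) ≈ 1#

fromℕ : ∀ {c ℓ} (K : Field c ℓ) → ℕ → Field.Carrier K
fromℕ K zero    = Field.0# K
fromℕ K (suc n) = Field._+_ K (Field.1# K) (fromℕ K n)

∀ᵇ : ∀ {n} → (Fin n → Bool) → Bool
∀ᵇ {n} p = all p (allFin n)

∃ᵇ : ∀ {n} → (Fin n → Bool) → Bool
∃ᵇ {n} p = any p (allFin n)

_<ᵇ_ : ∀ {n} → Fin n → Fin n → Bool
i <ᵇ j = ⌊ i <? j ⌋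

_≟ᵇ_ : ∀ {n} → Fin n → Fin n → Bool
i ≟ᵇ j = ⌊ i ≟ j ⌋

_⇒ᵇ_ : Bool → Bool → Bool
a ⇒ᵇ b = not a ∨ b

Rel : ℕ → Set
Rel n = Fin n → Fin n → Bool

_≐ᵇ_ : ∀ {n} → Rel n → Rel n → Bool
R ≐ᵇ S = ∀ᵇ λ i → ∀ᵇ λ j → (R i j ∧ S i j) ∨ (not (R i j) ∧ not (S i j))

transpose : ∀ {n} → Rel n → Rel n
transpose R i j = R j i

isPoset : ∀ {n} → Rel n → Bool
isPoset R =
  (∀ᵇ λ i → R i i) ∧
  (∀ᵇ λ i → ∀ᵇ λ j → (R i j ∧ R j i) ⇒ᵇ (i ≟ᵇ j)) ∧
  (∀ᵇ λ i → ∀ᵇ λ j → ∀ᵇ λ k → (R i j ∧ R j k) ⇒ᵇ R i k)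

isIWOIPcond : ∀ {n} → Rel n → Bool
isIWOIPcond R = ∀ᵇ λ a → ∀ᵇ λ b → ∀ᵇ λ c →
  ((a <ᵇ b) ∧ (b <ᵇ c) ∧ R a c) ⇒ᵇ (R a b ∨ R b c)

isDWOIPcond : ∀ {n} → Rel n → Bool
isDWOIPcond R = ∀ᵇ λ a → ∀ᵇ λ b → ∀ᵇ λ c →
  ((a <ᵇ b) ∧ (b <ᵇ c) ∧ R c a) ⇒ᵇ (R b a ∨ R c b)

isIWOIP isDWOIP isWOIP : ∀ {n} → Rel n → Bool
isIWOIP R = isPoset R ∧ isIWOIPcond R
isDWOIP R = isPoset R ∧ isDWOIPcond R
isWOIP  R = isPoset R ∧ isIWOIPcond R ∧ isDWOIPcond R

-- Chains in [n] have < n steps, so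
-- fuel n suffices: chain R x y = chainᵏ R n x y.

chainᵏ : ∀ {n} → Rel n → ℕ → Fin n → Fin n → Bool
chainᵏ R zero    x y = (x <ᵇ y) ∧ not (R x y)
chainᵏ R (suc k) x y =
  ((x <ᵇ y) ∧ not (R x y)) ∨
  (∃ᵇ λ z → (x <ᵇ z) ∧ not (R x z) ∧ chainᵏ R k z y)

chain : ∀ {n} → Rel n → Fin n → Fin n → Bool
chain {n} R = chainᵏ R n

removedI : ∀ {n} → Rel n → Fin n → Fin n → Bool
removedI R a c = (a <ᵇ c) ∧ (∃ᵇ λ b → (a <ᵇ b) ∧ not (R a b) ∧ chain R b c)

dI : ∀ {n} → Rel n → Rel n
dI R i j = R i j ∧ not (removedI R i j)

-- (c , a) with a < c is removed by d_D iff there are k ≥ 1 and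
-- a < b₁ < … < b_k < c with a ⊁ b₁ ⊁ … ⊁ b_k ⊁ c,
-- i.e. a chain of non-relations for the transposed relation.
dD : ∀ {n} → Rel n → Rel n
dD R i j = R i j ∧ not (removedI (transpose R) j i)

d : ∀ {n} → Rel n → Rel n
d R = dI (dD R)

allFuns : ∀ {A : Set} (m : ℕ) → List A → List (Vector A m)
allFuns zero    xs = (λ ()) ∷ []
allFuns (suc m) xs = concatMap (λ a → map (λ f → a ∷ᶠ f) (allFuns m xs)) xs

allRel : (n : ℕ) → List (Rel n)
allRel n = allFuns n (allFuns n (true ∷ false ∷ []))

count : ∀ {A : Set} → (A → Bool) → List A → ℕ
count p []       = zero
count p (x ∷ xs) = if p x then suc (count p xs) else count p xs

-- T ∈ Sh(P , Q) : T restricted to [m]×[m] is P and to [m+1,m+n]² is Q̄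
-- (pairs between the two blocks are arbitrary).
inShuffle : ∀ {m n} → Rel m → Rel n → Rel (m + n) → Bool
inShuffle {m} {n} P Q T =
  ((λ i j → T (i ↑ˡ n) (j ↑ˡ n)) ≐ᵇ P) ∧ ((λ i j → T (m ↑ʳ i) (m ↑ʳ j)) ≐ᵇ Q)

increasing : ∀ {m p} → (Fin m → Fin p) → Bool
increasing f = ∀ᵇ λ i → ∀ᵇ λ j → (i <ᵇ j) ⇒ᵇ (f i <ᵇ f j)

-- T ∈ R ⋆ S : there is a total cut (X , Y) of T with T_X = R, T_Y = S.
-- X = {f 1 < … < f m}, Y = {g 1 < … < g n} (increasing enumerations,
-- disjoint, hence a partition of [m+n]).
inStar : ∀ {m n} → Rel m → Rel n → Rel (m + n) → Bool
inStar {m} {n} R S T =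
  any (λ f → any (λ g →
        increasing f ∧ increasing g ∧
        (∀ᵇ λ i → ∀ᵇ λ j → not (f i ≟ᵇ g j)) ∧
        (∀ᵇ λ i → ∀ᵇ λ j → T (f i) (g j) ∧ not (T (g j) (f i))) ∧
        ((λ i j → T (f i) (f j)) ≐ᵇ R) ∧
        ((λ i j → T (g i) (g j)) ≐ᵇ S))
      (allFuns n (allFin (m + n))))
    (allFuns m (allFin (m + n)))

-- Coefficients in the basis (F_≺) of K IPos, for G_⊲ = Σ_{d'(≺) = ⊲} F_≺
-- (d' a projection IPos → class).

-- coefficient of F_T in G_a · G_b
--   = #{(P , Q) : P, Q posets, d' P = a, d' Q = b, T ∈ Sh(P , Q) ∩ IPos}
prodCoef : (proj : ∀ {k} → Rel k → Rel k) →
           ∀ {m n} → Rel m → Rel n → Rel (m + n) → ℕ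
prodCoef proj {m} {n} a b T =
  count (λ { (P , Q) → isPoset P ∧ (proj P ≐ᵇ a) ∧ isPoset Q ∧ (proj Q ≐ᵇ b) ∧
                       isPoset T ∧ inShuffle P Q T })
        (concatMap (λ P → map (λ Q → (P , Q)) (allRel n)) (allRel m))

-- coefficient of F_R ⊗ F_S in Δ(G_c)
--   = #{T : T poset, d' T = c, T ∈ R ⋆ S}
coprodCoef : (proj : ∀ {k} → Rel k → Rel k) →
             ∀ {m n} → Rel (m + n) → Rel m → Rel n → ℕ
coprodCoef proj {m} {n} c R S =
  count (λ T → isPoset T ∧ (proj T ≐ᵇ c) ∧ inStar R S T) (allRel (m + n))

-- An element Σ_T x_T F_T of degree p lies in the span of the G_⊲ iff
-- x_T = e(d' T) for some e (T ranging over posets), since the G_⊲ have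
-- disjoint supports (the fibres of d'), each containing ⊲ itself.
-- Likewise Σ x_{R,S} F_R ⊗ F_S lies in span{G_⊲ ⊗ G_⊲'} iff
-- x_{R,S} = e(d' R , d' S).

module _ {c ℓ} (K : Field c ℓ) where
  open Field K using (Carrier; _≈_)

  ProductStable : (isClass : ∀ {k} → Rel k → Bool)
                  (proj : ∀ {k} → Rel k → Rel k) → Set (c ⊔ ℓ)
  ProductStable isClass proj =
    ∀ m n (a : Rel m) (b : Rel n) → isClass a ≡ true → isClass b ≡ true →
    Σ (Rel (m + n) → Carrier) λ e →
      ∀ (T : Rel (m + n)) → isPoset T ≡ true →
        fromℕ K (prodCoef proj a b T) ≈ e (proj T)

  CoproductStable : (isClass : ∀ {k} → Rel k → Bool)
                    (proj : ∀ {k} → Rel k → Rel k) → Set (c ⊔ ℓ)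
  CoproductStable isClass proj =
    ∀ m n (γ : Rel (m + n)) → isClass γ ≡ true →
    Σ (Rel m → Rel n → Carrier) λ e →
      ∀ (R : Rel m) (S : Rel n) → isPoset R ≡ true → isPoset S ≡ true →
        fromℕ K (coprodCoef proj γ R S) ≈ e (proj R) (proj S)

{-# OPTIONS --safe #-}
-- Whether d_I removes a pair (a , c) is decided by chains a < b₁ < … < b_k < c of
-- non-relations a ⊀ b₁ ⊀ … ⊀ c.  Such a chain between two points of an interval of [p]
-- stays in the interval, and one between two points of a block of a total cut (X , Y)
-- stays in that block: X ≺ Y forbids a step out of X, hence any chain from X to Y.
-- So d_I commutes with restriction to intervals and to the blocks of total cuts, and it
-- preserves total cuts; so do d_D, which is d_I conjugated by transposition, and
-- d = d_I ∘ d_D.  Let proj be any of the three.  For a poset T on [m + n] the only pair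
-- (P , Q) with T ∈ Sh(P , Q) is the pair of restrictions of T to [1, m] and [m+1, m+n];
-- hence the coefficient of F_T in G_a · G_b is 1 or 0 according as proj T restricts to
-- a and b, a function of proj T.  Dually, a poset T with proj T = γ lies in R ⋆ S along
-- a total cut that is also one of γ, and γ has at most one total cut with |X| = m; so the
-- coefficient of F_R ⊗ F_S in Δ(G_γ) is 1 or 0 according as γ ∈ proj R ⋆ proj S.
module Submission where

open import Defs
open import Level using (Level)
open import Data.Bool using (Bool; true; false; _∧_; _∨_; not; if_then_else_; T)
open import Data.Bool.Properties using (∧-zeroʳ; ∧-assoc; T-≡; T-not-≡; ¬-not)
open import Data.Bool.ListAction using (any; and; or)
open import Data.Nat as ℕ using (ℕ; zero; suc; _+_; _*_)
import Data.Nat.Properties as ℕ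
open import Data.Fin as Fin using (Fin; _<_; _↑ˡ_; _↑ʳ_; toℕ; splitAt; join; punchOut)
open import Data.Fin.Induction using (<-wellFounded)
open import Induction.WellFounded using (module All)
open import Data.Fin.Properties using (_≟_; any?; all?; punchOut-injective; injective⇒≤; join-splitAt; ¬∀⟶∃¬; toℕ-↑ˡ; toℕ-↑ʳ; toℕ<n; splitAt⁻¹-↑ˡ; splitAt⁻¹-↑ʳ; <-cmp; <-irrefl; <-asym)
open import Relation.Binary.Definitions using (tri<; tri≈; tri>)
open import Data.List using (List; []; _∷_; map; concatMap; allFin; _++_)
open import Data.List.Properties using (map-cong; map-tabulate)
import Data.List.Relation.Unary.All as ListAll
open import Data.List.Relation.Unary.All.Properties using (all⁺; all⁻)
open import Data.List.Relation.Unary.Any.Properties using (any⁺; any⁻)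
open import Data.List.Membership.Propositional using (_∈_; find; lose)
open import Data.List.Membership.Propositional.Properties using (∈-allFin)
open import Data.Vec.Functional using () renaming (_∷_ to _∷ᶠ_)
open import Data.Product using (Σ; ∃; _×_; _,_; proj₁; proj₂)
open import Data.Sum using (_⊎_; inj₁; inj₂; [_,_]′)
open import Relation.Nullary using (¬_; yes; no)
open import Data.Empty using (⊥; ⊥-elim)
open import Function using (_∘_; _on_; Equivalence)
open import Function.Definitions using (Injective)
open import Relation.Binary.Structures using (IsPartialOrder)
open import Relation.Binary.Construct.Closure.Transitive using (TransClosure; [_]; _∷_)
open import Relation.Nullary.Decidable using (toWitness; fromWitness; fromWitnessFalse)
open import Relation.Binary.PropositionalEquality

private variable
  A B C : Set
  k m n p : ℕ

T⇒true : ∀ {b} → T b → b ≡ true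
T⇒true = Equivalence.to T-≡

true⇒T : ∀ {b} → b ≡ true → T b
true⇒T = Equivalence.from T-≡

true≢false : ∀ {b} → b ≡ true → b ≡ false → ⊥
true≢false refl ()

true-iff⇒≡ : ∀ {a b} → (a ≡ true → b ≡ true) → (b ≡ true → a ≡ true) → a ≡ b
true-iff⇒≡ {true}  to   from = sym (to refl)
true-iff⇒≡ {false} {false} to from = refl
true-iff⇒≡ {false} {true}  to from = from refl

∧⁻ : ∀ {a b} → a ∧ b ≡ true → a ≡ true × b ≡ true
∧⁻ {true} e = refl , e

∧⁺ : ∀ {a b} → a ≡ true → b ≡ true → a ∧ b ≡ true
∧⁺ refl refl = refl

∨⁺ˡ : ∀ {a b} → a ≡ true → a ∨ b ≡ true
∨⁺ˡ refl = refl

∨⁺ʳ : ∀ {a b} → b ≡ true → a ∨ b ≡ true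
∨⁺ʳ {true}  _ = refl
∨⁺ʳ {false} e = e

∨⁻ : ∀ {a b} → a ∨ b ≡ true → a ≡ true ⊎ b ≡ true
∨⁻ {true}  _ = inj₁ refl
∨⁻ {false} e = inj₂ e

not⁻ : ∀ {a} → not a ≡ true → a ≡ false
not⁻ {false} _ = refl

not⁺ : ∀ {a} → a ≡ false → not a ≡ true
not⁺ refl = refl

⇒ᵇ⁻ : ∀ {a b} → (a ⇒ᵇ b) ≡ true → a ≡ true → b ≡ true
⇒ᵇ⁻ e refl = e

⇒ᵇ⁺ : ∀ {a b} → (a ≡ true → b ≡ true) → (a ⇒ᵇ b) ≡ true
⇒ᵇ⁺ {true}  h = h refl
⇒ᵇ⁺ {false} h = refl

any⁺-∈ : ∀ {p : A → Bool} {x xs} → x ∈ xs → p x ≡ true → any p xs ≡ true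
any⁺-∈ {p = p} x∈xs px = T⇒true (any⁺ p (lose x∈xs (true⇒T px)))

any⁻-∈ : ∀ {p : A → Bool} xs → any p xs ≡ true → ∃ λ x → x ∈ xs × p x ≡ true
any⁻-∈ {p = p} xs e with x , x∈xs , px ← find (any⁻ p xs (true⇒T e)) = x , x∈xs , T⇒true px

∀ᵇ⁻ : {P : Fin n → Bool} → ∀ᵇ P ≡ true → ∀ i → P i ≡ true
∀ᵇ⁻ {n} {P} e i = T⇒true (ListAll.lookup (all⁺ P (allFin n) (true⇒T e)) (∈-allFin i))

∀ᵇ⁺ : {P : Fin n → Bool} → (∀ i → P i ≡ true) → ∀ᵇ P ≡ true
∀ᵇ⁺ {n} {P} h = T⇒true (all⁻ P (ListAll.tabulate {xs = allFin n} λ {i} _ → true⇒T (h i)))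

∃ᵇ⁻ : {P : Fin n → Bool} → ∃ᵇ P ≡ true → ∃ λ i → P i ≡ true
∃ᵇ⁻ {n} e with i , _ , Pi ← any⁻-∈ (allFin n) e = i , Pi

∃ᵇ⁺ : {P : Fin n → Bool} → ∀ i → P i ≡ true → ∃ᵇ P ≡ true
∃ᵇ⁺ i = any⁺-∈ (∈-allFin i)

∀ᵇ-cong : {P Q : Fin n → Bool} → (∀ i → P i ≡ Q i) → ∀ᵇ P ≡ ∀ᵇ Q
∀ᵇ-cong {n} e = cong and (map-cong e (allFin n))

∃ᵇ-cong : {P Q : Fin n → Bool} → (∀ i → P i ≡ Q i) → ∃ᵇ P ≡ ∃ᵇ Q
∃ᵇ-cong {n} e = cong or (map-cong e (allFin n))

∀ᵇ-suc : (P : Fin (suc n) → Bool) → ∀ᵇ P ≡ P Fin.zero ∧ ∀ᵇ (P ∘ Fin.suc)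
∀ᵇ-suc {n} P = cong (λ bs → P Fin.zero ∧ and bs)
  (trans (map-tabulate Fin.suc P) (sym (map-tabulate (λ i → i) (P ∘ Fin.suc))))

<ᵇ⁻ : {i j : Fin n} → (i <ᵇ j) ≡ true → i < j
<ᵇ⁻ e = toWitness (true⇒T e)

<ᵇ⁺ : {i j : Fin n} → i < j → (i <ᵇ j) ≡ true
<ᵇ⁺ i<j = T⇒true (fromWitness i<j)

≟ᵇ⁻ : {i j : Fin n} → (i ≟ᵇ j) ≡ true → i ≡ j
≟ᵇ⁻ e = toWitness (true⇒T e)

≟ᵇ⁺ : {i j : Fin n} → i ≡ j → (i ≟ᵇ j) ≡ true
≟ᵇ⁺ i≡j = T⇒true (fromWitness i≡j)

≟ᵇ-≢ : {i j : Fin n} → i ≢ j → (i ≟ᵇ j) ≡ false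
≟ᵇ-≢ i≢j = Equivalence.to T-not-≡ (fromWitnessFalse i≢j)

infix 4 _≋_

_≋_ : Rel n → Rel n → Set
R ≋ S = ∀ i j → R i j ≡ S i j

≋-sym : {R S : Rel n} → R ≋ S → S ≋ R
≋-sym R≋S i j = sym (R≋S i j)

≋-trans : {R S U : Rel n} → R ≋ S → S ≋ U → R ≋ U
≋-trans R≋S S≋U i j = trans (R≋S i j) (S≋U i j)

≐ᵇ⁻ : {R S : Rel n} → (R ≐ᵇ S) ≡ true → R ≋ S
≐ᵇ⁻ e i j = agree (∀ᵇ⁻ (∀ᵇ⁻ e i) j)
  where
  agree : ∀ {x y} → (x ∧ y) ∨ (not x ∧ not y) ≡ true → x ≡ y
  agree {true}  {true}  _ = refl
  agree {false} {false} _ = refl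

≐ᵇ⁺ : {R S : Rel n} → R ≋ S → (R ≐ᵇ S) ≡ true
≐ᵇ⁺ {R = R} R≋S = ∀ᵇ⁺ λ i → ∀ᵇ⁺ λ j →
  subst (λ y → (R i j ∧ y) ∨ (not (R i j) ∧ not y) ≡ true) (R≋S i j) (agree-refl (R i j))
  where
  agree-refl : ∀ x → (x ∧ x) ∨ (not x ∧ not x) ≡ true
  agree-refl true  = refl
  agree-refl false = refl

≐ᵇ-congˡ : {R R′ : Rel n} (S : Rel n) → R ≋ R′ → (R ≐ᵇ S) ≡ (R′ ≐ᵇ S)
≐ᵇ-congˡ S R≋R′ = ∀ᵇ-cong λ i → ∀ᵇ-cong λ j →
  cong (λ x → (x ∧ S i j) ∨ (not x ∧ not (S i j))) (R≋R′ i j)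

count-cong : {P Q : A → Bool} → (∀ x → P x ≡ Q x) → ∀ xs → count P xs ≡ count Q xs
count-cong P≗Q []       = refl
count-cong P≗Q (x ∷ xs) rewrite P≗Q x = cong (λ c → if _ then suc c else c) (count-cong P≗Q xs)

count-++ : (P : A → Bool) (xs ys : List A) → count P (xs ++ ys) ≡ count P xs + count P ys
count-++ P []       ys = refl
count-++ P (x ∷ xs) ys with P x
... | true  = cong suc (count-++ P xs ys)
... | false = count-++ P xs ys

count-map : (P : B → Bool) (f : A → B) (xs : List A) → count P (map f xs) ≡ count (P ∘ f) xs
count-map P f []       = refl
count-map P f (x ∷ xs) with P (f x)
... | true  = cong suc (count-map P f xs)
... | false = count-map P f xs

count-false : {P : A → Bool} → (∀ x → P x ≡ false) → ∀ xs → count P xs ≡ 0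
count-false P≗false []       = refl
count-false P≗false (x ∷ xs) rewrite P≗false x = count-false P≗false xs

count-∧ˡ : (b : Bool) (P : A → Bool) (xs : List A) →
           count (λ x → b ∧ P x) xs ≡ (if b then count P xs else 0)
count-∧ˡ true  P xs = refl
count-∧ˡ false P xs = count-false (λ _ → refl) xs

count-concatMap : (P : C → Bool) (h : A → B → C) (ys : List B) (e : A → Bool) (c : ℕ) →
                  (∀ x → count (P ∘ h x) ys ≡ (if e x then c else 0)) →
                  ∀ xs → count P (concatMap (λ x → map (h x) ys) xs) ≡ count e xs * c
count-concatMap P h ys e c row []       = refl
count-concatMap P h ys e c row (x ∷ xs) = begin
  count P (map (h x) ys ++ concatMap (λ x → map (h x) ys) xs)
    ≡⟨ count-++ P (map (h x) ys) _ ⟩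
  count P (map (h x) ys) + count P (concatMap (λ x → map (h x) ys) xs)
    ≡⟨ cong₂ _+_ (trans (count-map P (h x) ys) (row x)) (count-concatMap P h ys e c row xs) ⟩
  (if e x then c else 0) + count e xs * c
    ≡⟨ add-row (e x) ⟩
  count e (x ∷ xs) * c ∎
  where
  open ≡-Reasoning
  add-row : ∀ b → (if b then c else 0) + count e xs * c ≡ (if b then suc (count e xs) else count e xs) * c
  add-row true  = refl
  add-row false = refl

count-singleton : (K P : A → Bool) (b : Bool) (xs : List A) → (∀ x → P x ≡ b ∧ K x) → count K xs ≡ 1 →
                  count P xs ≡ (if b then 1 else 0)
count-singleton K P b xs P≡b∧K K-once = begin
  count P xs                    ≡⟨ count-cong P≡b∧K xs ⟩
  count (λ x → b ∧ K x) xs      ≡⟨ count-∧ˡ b K xs ⟩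
  (if b then count K xs else 0) ≡⟨ cong (λ c → if b then c else 0) K-once ⟩
  (if b then 1 else 0)          ∎
  where open ≡-Reasoning

Enumerates : (A → A → Bool) → List A → Set
Enumerates _≈ᵇ_ xs = ∀ x → count (x ≈ᵇ_) xs ≡ 1

allFuns-enumerates : {_≈ᵇ_ : A → A → Bool} {xs : List A} → Enumerates _≈ᵇ_ xs →
                     ∀ m → Enumerates (λ f g → ∀ᵇ λ i → f i ≈ᵇ g i) (allFuns m xs)
allFuns-enumerates enum zero    f = refl
allFuns-enumerates {_≈ᵇ_ = _≈ᵇ_} {xs} enum (suc m) f = begin
  count (λ g → ∀ᵇ λ i → f i ≈ᵇ g i) (concatMap (λ a → map (a ∷ᶠ_) (allFuns m xs)) xs)
    ≡⟨ count-concatMap _ _∷ᶠ_ (allFuns m xs) (f Fin.zero ≈ᵇ_) 1 first-entry xs ⟩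
  count (f Fin.zero ≈ᵇ_) xs * 1
    ≡⟨ ℕ.*-identityʳ _ ⟩
  count (f Fin.zero ≈ᵇ_) xs
    ≡⟨ enum (f Fin.zero) ⟩
  1 ∎
  where
  open ≡-Reasoning
  first-entry : ∀ a → count (λ g → ∀ᵇ λ i → f i ≈ᵇ (a ∷ᶠ g) i) (allFuns m xs) ≡
                       (if f Fin.zero ≈ᵇ a then 1 else 0)
  first-entry a = begin
    count (λ g → ∀ᵇ λ i → f i ≈ᵇ (a ∷ᶠ g) i) (allFuns m xs)
      ≡⟨ count-cong (λ g → ∀ᵇ-suc (λ i → f i ≈ᵇ (a ∷ᶠ g) i)) (allFuns m xs) ⟩
    count (λ g → (f Fin.zero ≈ᵇ a) ∧ ∀ᵇ λ i → f (Fin.suc i) ≈ᵇ g i) (allFuns m xs)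
      ≡⟨ count-∧ˡ (f Fin.zero ≈ᵇ a) (λ g → ∀ᵇ λ i → f (Fin.suc i) ≈ᵇ g i) (allFuns m xs) ⟩
    (if f Fin.zero ≈ᵇ a then count (λ g → ∀ᵇ λ i → f (Fin.suc i) ≈ᵇ g i) (allFuns m xs) else 0)
      ≡⟨ cong (λ c → if f Fin.zero ≈ᵇ a then c else 0) (allFuns-enumerates enum m (f ∘ Fin.suc)) ⟩
    (if f Fin.zero ≈ᵇ a then 1 else 0) ∎

allRel-enumerates : ∀ n → Enumerates _≐ᵇ_ (allRel n)
allRel-enumerates n = allFuns-enumerates (allFuns-enumerates {_≈ᵇ_ = agreeᵇ} bools-enumerate n) n
  where
  agreeᵇ : Bool → Bool → Bool
  agreeᵇ x y = (x ∧ y) ∨ (not x ∧ not y)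
  bools-enumerate : Enumerates agreeᵇ (true ∷ false ∷ [])
  bools-enumerate true  = refl
  bools-enumerate false = refl

pairs : List A → List B → List (A × B)
pairs xs ys = concatMap (λ x → map (λ y → (x , y)) ys) xs

pairs-enumerates : {_≈₁_ : A → A → Bool} {_≈₂_ : B → B → Bool} {xs : List A} {ys : List B} →
                   Enumerates _≈₁_ xs → Enumerates _≈₂_ ys →
                   Enumerates (λ u v → (proj₁ u ≈₁ proj₁ v) ∧ (proj₂ u ≈₂ proj₂ v)) (pairs xs ys)
pairs-enumerates {_≈₁_ = _≈₁_} {_≈₂_} {xs} {ys} enum₁ enum₂ (x , y) = begin
  count (λ v → (x ≈₁ proj₁ v) ∧ (y ≈₂ proj₂ v)) (pairs xs ys)
    ≡⟨ count-concatMap _ _,_ ys (x ≈₁_) 1 second xs ⟩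
  count (x ≈₁_) xs * 1 ≡⟨ ℕ.*-identityʳ _ ⟩
  count (x ≈₁_) xs     ≡⟨ enum₁ x ⟩
  1 ∎
  where
  open ≡-Reasoning
  second : ∀ a → count (λ b → (x ≈₁ a) ∧ (y ≈₂ b)) ys ≡ (if x ≈₁ a then 1 else 0)
  second a = trans (count-∧ˡ (x ≈₁ a) (y ≈₂_) ys) (cong (λ c → if x ≈₁ a then c else 0) (enum₂ y))

⟦_⟧ : Rel n → Fin n → Fin n → Set
⟦ R ⟧ i j = R i j ≡ true

IsPoset : Rel n → Set
IsPoset R = IsPartialOrder _≡_ ⟦ R ⟧

mkIsPoset : {R : Rel n} → (∀ i → R i i ≡ true) →
            (∀ {i j} → R i j ≡ true → R j i ≡ true → i ≡ j) →
            (∀ {i j k} → R i j ≡ true → R j k ≡ true → R i k ≡ true) → IsPoset R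
mkIsPoset refl′ antisym trans′ = record
  { isPreorder = record
    { isEquivalence = isEquivalence
    ; reflexive     = λ { refl → refl′ _ }
    ; trans         = trans′
    }
  ; antisym = antisym
  }

isPoset⁻ : {R : Rel n} → isPoset R ≡ true → IsPoset R
isPoset⁻ {R = R} e with refl-ok , e′ ← ∧⁻ e with antisym-ok , trans-ok ← ∧⁻ e′ =
  mkIsPoset (∀ᵇ⁻ refl-ok)
    (λ {i} {j} Rij Rji → ≟ᵇ⁻ (⇒ᵇ⁻ (∀ᵇ⁻ (∀ᵇ⁻ antisym-ok i) j) (∧⁺ Rij Rji)))
    (λ {i} {j} {k} Rij Rjk → ⇒ᵇ⁻ (∀ᵇ⁻ (∀ᵇ⁻ (∀ᵇ⁻ trans-ok i) j) k) (∧⁺ Rij Rjk))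

isPoset⁺ : {R : Rel n} → IsPoset R → isPoset R ≡ true
isPoset⁺ {R = R} po = ∧⁺ (∀ᵇ⁺ λ i → IsPartialOrder.refl po {i}) (∧⁺
  (∀ᵇ⁺ λ i → ∀ᵇ⁺ λ j → ⇒ᵇ⁺ λ e →
    let Rij , Rji = ∧⁻ {R i j} e in ≟ᵇ⁺ (IsPartialOrder.antisym po Rij Rji))
  (∀ᵇ⁺ λ i → ∀ᵇ⁺ λ j → ∀ᵇ⁺ λ k → ⇒ᵇ⁺ λ e →
    let Rij , Rjk = ∧⁻ {R i j} e in IsPartialOrder.trans po {i} {j} {k} Rij Rjk))

isPoset-cong : {R R′ : Rel n} → R ≋ R′ → isPoset R ≡ isPoset R′
isPoset-cong R≋R′ = cong₂ _∧_ (∀ᵇ-cong λ i → R≋R′ i i) (cong₂ _∧_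
  (∀ᵇ-cong λ i → ∀ᵇ-cong λ j → cong (_⇒ᵇ (i ≟ᵇ j)) (cong₂ _∧_ (R≋R′ i j) (R≋R′ j i)))
  (∀ᵇ-cong λ i → ∀ᵇ-cong λ j → ∀ᵇ-cong λ k →
    cong₂ _⇒ᵇ_ (cong₂ _∧_ (R≋R′ i j) (R≋R′ j k)) (R≋R′ i k)))

IsPoset-on : {T : Rel p} {φ : Fin k → Fin p} → Injective _≡_ _≡_ φ → IsPoset T → IsPoset (T on φ)
IsPoset-on φ-injective po = mkIsPoset (λ _ → IsPartialOrder.refl po)
  (λ Rij Rji → φ-injective (IsPartialOrder.antisym po Rij Rji)) (IsPartialOrder.trans po)

Img : (Fin k → Fin p) → Fin p → Set
Img φ z = ∃ λ i → φ i ≡ z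

Increasing : (Fin k → Fin p) → Set
Increasing φ = ∀ {i j} → i < j → φ i < φ j

module _ {φ : Fin k → Fin p} (φ-increasing : Increasing φ) where

  increasing-reflects : ∀ {i j} → φ i < φ j → i < j
  increasing-reflects {i} {j} φi<φj with <-cmp i j
  ... | tri< i<j _ _ = i<j
  ... | tri≈ _ refl _ = ⊥-elim (<-irrefl refl φi<φj)
  ... | tri> _ _ j<i = ⊥-elim (<-asym φi<φj (φ-increasing j<i))

  increasing-injective : Injective _≡_ _≡_ φ
  increasing-injective {i} {j} φi≡φj with <-cmp i j
  ... | tri< i<j _ _ = ⊥-elim (<-irrefl φi≡φj (φ-increasing i<j))
  ... | tri≈ _ i≡j _ = i≡j
  ... | tri> _ _ j<i = ⊥-elim (<-irrefl (sym φi≡φj) (φ-increasing j<i))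

injective⇒surjective : ∀ {q} {h : Fin q → Fin q} → Injective _≡_ _≡_ h → ∀ z → Img h z
injective⇒surjective {suc q} {h} h-injective z with any? (λ i → h i ≟ z)
... | yes z∈img = z∈img
... | no  z∉img = ⊥-elim (ℕ.<-irrefl refl (injective⇒≤ h-without-z-injective))
  where
  h≢z : ∀ i → z ≢ h i
  h≢z i z≡hi = z∉img (i , sym z≡hi)
  h-without-z : Fin (suc q) → Fin q
  h-without-z i = punchOut (h≢z i)
  h-without-z-injective : Injective _≡_ _≡_ h-without-z
  h-without-z-injective {i} {j} e = h-injective (punchOut-injective (h≢z i) (h≢z j) e)

Img-⊆-reverse : {f₁ f₂ : Fin m → Fin p} → Injective _≡_ _≡_ f₁ →
                (∀ a → Img f₂ (f₁ a)) → ∀ a → Img f₁ (f₂ a)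
Img-⊆-reverse {f₁ = f₁} {f₂} f₁-injective f₁⊆f₂ a =
  let b , σb≡a = injective⇒surjective σ-injective a in b , trans (sym (proj₂ (f₁⊆f₂ b))) (cong f₂ σb≡a)
  where
  σ : _ → _
  σ b = proj₁ (f₁⊆f₂ b)
  σ-injective : Injective _≡_ _≡_ σ
  σ-injective {b} {b′} σb≡σb′ =
    f₁-injective (trans (sym (proj₂ (f₁⊆f₂ b))) (trans (cong f₂ σb≡σb′) (proj₂ (f₁⊆f₂ b′))))

agree-below⇒≮ : {f₁ f₂ : Fin m → Fin p} → Increasing f₁ → Increasing f₂ → ∀ {a} → Img f₂ (f₁ a) →
                (∀ {b} → b < a → f₁ b ≡ f₂ b) → ¬ (f₁ a < f₂ a)
agree-below⇒≮ {f₁ = f₁} {f₂} f₁-increasing f₂-increasing {a} (b , f₂b≡f₁a) agree f₁a<f₂a =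
  <-irrefl (increasing-injective f₁-increasing (trans (agree b<a) f₂b≡f₁a)) b<a
  where
  b<a : b < a
  b<a = increasing-reflects f₂-increasing (subst (_< f₂ a) (sym f₂b≡f₁a) f₁a<f₂a)

increasing-⊆⇒≗ : {f₁ f₂ : Fin m → Fin p} → Increasing f₁ → Increasing f₂ →
                 (∀ a → Img f₂ (f₁ a)) → ∀ a → f₁ a ≡ f₂ a
increasing-⊆⇒≗ {f₁ = f₁} {f₂} f₁-increasing f₂-increasing f₁⊆f₂ =
  All.wfRec <-wellFounded _ (λ a → f₁ a ≡ f₂ a) step
  where
  f₂⊆f₁ = Img-⊆-reverse (increasing-injective f₁-increasing) f₁⊆f₂
  step : ∀ a → (∀ {b} → b < a → f₁ b ≡ f₂ b) → f₁ a ≡ f₂ a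
  step a agree with <-cmp (f₁ a) (f₂ a)
  ... | tri≈ _ f₁a≡f₂a _ = f₁a≡f₂a
  ... | tri< f₁a<f₂a _ _ = ⊥-elim (agree-below⇒≮ f₁-increasing f₂-increasing (f₁⊆f₂ a) agree f₁a<f₂a)
  ... | tri> _ _ f₂a<f₁a =
    ⊥-elim (agree-below⇒≮ f₂-increasing f₁-increasing (f₂⊆f₁ a) (λ b<a → sym (agree b<a)) f₂a<f₁a)

Gap : Rel p → Fin p → Fin p → Set
Gap T x y = x < y × T x y ≡ false

Chain : Rel p → Fin p → Fin p → Set
Chain T = TransClosure (Gap T)

Removed : Rel p → Fin p → Fin p → Set
Removed T a c = ∃ λ b → Gap T a b × Chain T b c

chain-< : {T : Rel p} {x y : Fin p} → Chain T x y → x < y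
chain-< [ x<y , _ ]        = x<y
chain-< ((x<z , _) ∷ z⋯y) = ℕ.<-trans x<z (chain-< z⋯y)

chainᵏ⁻ : (T : Rel p) (k : ℕ) {x y : Fin p} → chainᵏ T k x y ≡ true → Chain T x y
chainᵏ⁻ T zero e with x<y , ¬Txy ← ∧⁻ e = [ <ᵇ⁻ x<y , not⁻ ¬Txy ]
chainᵏ⁻ T (suc k) {x} {y} e with ∨⁻ e
... | inj₁ e′ with x<y , ¬Txy ← ∧⁻ e′ = [ <ᵇ⁻ x<y , not⁻ ¬Txy ]
... | inj₂ e′ with ∃ᵇ⁻ {P = λ z → (x <ᵇ z) ∧ not (T x z) ∧ chainᵏ T k z y} e′
... | z , e″ with x<z , e‴ ← ∧⁻ {x <ᵇ z} e″ with ¬Txz , z⋯y ← ∧⁻ {not (T x z)} e‴ =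
  (<ᵇ⁻ x<z , not⁻ ¬Txz) ∷ chainᵏ⁻ T k z⋯y

-- chainᵏ T k allows at most k + 1 steps, and every step moves right.
chainᵏ⁺ : {T : Rel p} {x y : Fin p} → Chain T x y →
          ∀ k → toℕ y ℕ.≤ toℕ x + suc k → chainᵏ T k x y ≡ true
chainᵏ⁺ [ x<y , ¬Txy ] zero    _ = ∧⁺ (<ᵇ⁺ x<y) (not⁺ ¬Txy)
chainᵏ⁺ {T = T} {x} {y} [ x<y , ¬Txy ] (suc k) _ =
  ∨⁺ˡ {b = ∃ᵇ λ z → (x <ᵇ z) ∧ not (T x z) ∧ chainᵏ T k z y} (∧⁺ (<ᵇ⁺ x<y) (not⁺ ¬Txy))
chainᵏ⁺ {x = x} {y} ((x<z , _) ∷ z⋯y) zero y≤x+1 = ⊥-elim (ℕ.<-irrefl refl (begin-strict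
  suc (toℕ x) <⟨ ℕ.≤-<-trans x<z (chain-< z⋯y) ⟩
  toℕ y       ≤⟨ y≤x+1 ⟩
  toℕ x + 1   ≡⟨ ℕ.+-comm (toℕ x) 1 ⟩
  suc (toℕ x) ∎))
  where open ℕ.≤-Reasoning
chainᵏ⁺ {T = T} {x} {y} (_∷_ {y = z} (x<z , ¬Txz) z⋯y) (suc k) y≤x+k+2 =
  ∨⁺ʳ {(x <ᵇ y) ∧ not (T x y)} (∃ᵇ⁺ {P = λ z → (x <ᵇ z) ∧ not (T x z) ∧ chainᵏ T k z y} z
    (∧⁺ (<ᵇ⁺ x<z) (∧⁺ (not⁺ ¬Txz) (chainᵏ⁺ z⋯y k y≤z+k+1))))
  where
  y≤z+k+1 : toℕ y ℕ.≤ toℕ z + suc k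
  y≤z+k+1 = ℕ.≤-trans y≤x+k+2
    (ℕ.≤-trans (ℕ.≤-reflexive (ℕ.+-suc (toℕ x) (suc k))) (ℕ.+-monoˡ-≤ (suc k) x<z))

chain⁺ : {T : Rel p} {x y : Fin p} → Chain T x y → chain T x y ≡ true
chain⁺ {p} {x = x} {y} x⋯y =
  chainᵏ⁺ x⋯y p (ℕ.≤-trans (ℕ.<⇒≤ (toℕ<n y)) (ℕ.≤-trans (ℕ.n≤1+n p) (ℕ.m≤n+m (suc p) (toℕ x))))

removedI⁻ : (T : Rel p) {a c : Fin p} → removedI T a c ≡ true → Removed T a c
removedI⁻ {p} T e
  with b , e′ ← ∃ᵇ⁻ (proj₂ (∧⁻ e))
  with a<b , e″ ← ∧⁻ e′
  with ¬Tab , b⋯c ← ∧⁻ e″ =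
  b , (<ᵇ⁻ a<b , not⁻ ¬Tab) , chainᵏ⁻ T p b⋯c

removedI⁺ : (T : Rel p) {a c : Fin p} → Removed T a c → removedI T a c ≡ true
removedI⁺ {p} T {a} {c} (b , (a<b , ¬Tab) , b⋯c) =
  ∧⁺ (<ᵇ⁺ (ℕ.<-trans a<b (chain-< b⋯c)))
     (∃ᵇ⁺ {P = λ b → (a <ᵇ b) ∧ not (T a b) ∧ chain T b c} b (∧⁺ (<ᵇ⁺ a<b) (∧⁺ (not⁺ ¬Tab) (chain⁺ b⋯c))))

removed⇒chain : {T : Rel p} {a c : Fin p} → Removed T a c → Chain T a c
removed⇒chain (_ , a<b , b⋯c) = a<b ∷ b⋯c

ChainClosed : (Fin k → Fin p) → Rel p → Set
ChainClosed φ T = ∀ {i c z} → Gap T (φ i) z → Chain T z (φ c) → Img φ z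

module _ {φ : Fin k → Fin p} (φ-increasing : Increasing φ) {T : Rel p} where

  chain-on⁺ : ∀ {i j} → Chain (T on φ) i j → Chain T (φ i) (φ j)
  chain-on⁺ [ i<j , ¬Tij ]        = [ φ-increasing i<j , ¬Tij ]
  chain-on⁺ ((i<l , ¬Til) ∷ l⋯j) = (φ-increasing i<l , ¬Til) ∷ chain-on⁺ l⋯j

  module _ (closed : ChainClosed φ T) where

    chain-on⁻ : ∀ {u v i c} → Chain T u v → u ≡ φ i → v ≡ φ c → Chain (T on φ) i c
    chain-on⁻ [ u<v , ¬Tuv ] refl refl = [ increasing-reflects φ-increasing u<v , ¬Tuv ]
    chain-on⁻ ((u<z , ¬Tuz) ∷ z⋯v) refl refl with closed (u<z , ¬Tuz) z⋯v
    ... | l , refl = (increasing-reflects φ-increasing u<z , ¬Tuz) ∷ chain-on⁻ z⋯v refl refl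

    removedI-on : ∀ a c → removedI (T on φ) a c ≡ removedI T (φ a) (φ c)
    removedI-on a c = true-iff⇒≡ restricted⇒ambient ambient⇒restricted
      where
      restricted⇒ambient : removedI (T on φ) a c ≡ true → removedI T (φ a) (φ c) ≡ true
      restricted⇒ambient e with b , (a<b , ¬Tab) , b⋯c ← removedI⁻ (T on φ) e =
        removedI⁺ T (φ b , (φ-increasing a<b , ¬Tab) , chain-on⁺ b⋯c)
      ambient⇒restricted : removedI T (φ a) (φ c) ≡ true → removedI (T on φ) a c ≡ true
      ambient⇒restricted e with z , gap , z⋯c ← removedI⁻ T e with closed gap z⋯c
      ... | b , refl = removedI⁺ (T on φ)
        (b , (increasing-reflects φ-increasing (proj₁ gap) , proj₂ gap) , chain-on⁻ z⋯c refl refl)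

    dI-on : dI (T on φ) ≋ (dI T on φ)
    dI-on i j = cong (λ r → T (φ i) (φ j) ∧ not r) (removedI-on i j)

Convex : (Fin k → Fin p) → Set
Convex φ = ∀ {i j z} → φ i < z → z < φ j → Img φ z

convex⇒chainClosed : {φ : Fin k → Fin p} {T : Rel p} → Convex φ → ChainClosed φ T
convex⇒chainClosed convex (φi<z , _) z⋯φc = convex φi<z (chain-< z⋯φc)

↑ˡ-increasing : Increasing {m} (_↑ˡ n)
↑ˡ-increasing {n = n} {i} {j} i<j = subst₂ ℕ._<_ (sym (toℕ-↑ˡ i n)) (sym (toℕ-↑ˡ j n)) i<j

↑ʳ-increasing : Increasing {n} (m ↑ʳ_)
↑ʳ-increasing {m = m} {i} {j} i<j =
  subst₂ ℕ._<_ (sym (toℕ-↑ʳ m i)) (sym (toℕ-↑ʳ m j)) (ℕ.+-monoʳ-< m i<j)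

↑ˡ-or-↑ʳ : (z : Fin (m + n)) → Img (_↑ˡ n) z ⊎ Img (m ↑ʳ_) z
↑ˡ-or-↑ʳ {m} z with splitAt m z in eq
... | inj₁ a = inj₁ (a , splitAt⁻¹-↑ˡ eq)
... | inj₂ b = inj₂ (b , splitAt⁻¹-↑ʳ eq)

↑ˡ-convex : Convex {m} (_↑ˡ n)
↑ˡ-convex {m} {n} {j = j} {z} _ z<j with ↑ˡ-or-↑ʳ {m} z
... | inj₁ img = img
... | inj₂ (b , refl) = ⊥-elim (ℕ.<-irrefl refl (begin-strict
  m                 ≤⟨ ℕ.m≤m+n m (toℕ b) ⟩
  m + toℕ b         ≡⟨ toℕ-↑ʳ m b ⟨
  toℕ (m ↑ʳ b)      <⟨ z<j ⟩
  toℕ (j ↑ˡ n)      ≡⟨ toℕ-↑ˡ j n ⟩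
  toℕ j             <⟨ toℕ<n j ⟩
  m                 ∎))
  where open ℕ.≤-Reasoning

↑ʳ-convex : Convex {n} (m ↑ʳ_)
↑ʳ-convex {n} {m} {i = i} {z = z} i<z _ with ↑ˡ-or-↑ʳ {m} z
... | inj₂ img = img
... | inj₁ (a , refl) = ⊥-elim (ℕ.<-irrefl refl (begin-strict
  m                 ≤⟨ ℕ.m≤m+n m (toℕ i) ⟩
  m + toℕ i         ≡⟨ toℕ-↑ʳ m i ⟨
  toℕ (m ↑ʳ i)      <⟨ i<z ⟩
  toℕ (a ↑ˡ n)      ≡⟨ toℕ-↑ˡ a n ⟩
  toℕ a             <⟨ toℕ<n a ⟩
  m                 ∎))
  where open ℕ.≤-Reasoning

record Splitting (f : Fin m → Fin p) (g : Fin n → Fin p) : Set where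
  field
    f-increasing : Increasing f
    g-increasing : Increasing g
    disjoint     : ∀ i j → f i ≢ g j
    cover        : ∀ z → Img f z ⊎ Img g z

splitting-swap : {f : Fin m → Fin p} {g : Fin n → Fin p} → Splitting f g → Splitting g f
splitting-swap split = record
  { f-increasing = g-increasing
  ; g-increasing = f-increasing
  ; disjoint     = λ i j gi≡fj → disjoint j i (sym gi≡fj)
  ; cover        = λ z → [ inj₂ , inj₁ ]′ (cover z)
  }
  where open Splitting split

disjoint⇒cover : {f : Fin m → Fin (m + n)} {g : Fin n → Fin (m + n)} → Increasing f → Increasing g →
                 (∀ i j → f i ≢ g j) → ∀ z → Img f z ⊎ Img g z
disjoint⇒cover {m} {n} {f} {g} f-increasing g-increasing disjoint z =
  let w , fgw≡z = injective⇒surjective fg-injective z in side w fgw≡z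
  where
  fg : Fin (m + n) → Fin (m + n)
  fg w = [ f , g ]′ (splitAt m w)
  fg-injective : Injective _≡_ _≡_ fg
  fg-injective {w} {w′} e = begin
    w                       ≡⟨ join-splitAt m n w ⟨
    join m n (splitAt m w)  ≡⟨ cong (join m n) (sides (splitAt m w) (splitAt m w′) e) ⟩
    join m n (splitAt m w′) ≡⟨ join-splitAt m n w′ ⟩
    w′                      ∎
    where
    open ≡-Reasoning
    sides : ∀ x y → [ f , g ]′ x ≡ [ f , g ]′ y → x ≡ y
    sides (inj₁ a) (inj₁ c) e = cong inj₁ (increasing-injective f-increasing e)
    sides (inj₁ a) (inj₂ d) e = ⊥-elim (disjoint a d e)
    sides (inj₂ b) (inj₁ c) e = ⊥-elim (disjoint c b (sym e))
    sides (inj₂ b) (inj₂ d) e = cong inj₂ (increasing-injective g-increasing e)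
  side : ∀ w → fg w ≡ z → Img f z ⊎ Img g z
  side w with splitAt m w
  ... | inj₁ a = λ fa≡z → inj₁ (a , fa≡z)
  ... | inj₂ b = λ gb≡z → inj₂ (b , gb≡z)

record TotalCut (f : Fin m → Fin p) (g : Fin n → Fin p) (U : Rel m) (V : Rel n) (T : Rel p) : Set where
  field
    on-f : (T on f) ≋ U
    on-g : (T on g) ≋ V
    f≺g  : ∀ a c → T (f a) (g c) ≡ true
    g⊀f  : ∀ a c → T (g c) (f a) ≡ false

module _ {f : Fin m → Fin p} {g : Fin n → Fin p} {U : Rel m} {V : Rel n} where

  totalCut-transpose : {T : Rel p} → TotalCut f g U V T → TotalCut g f (transpose V) (transpose U) (transpose T)
  totalCut-transpose cut = record
    { on-f = λ i j → on-g j i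
    ; on-g = λ i j → on-f j i
    ; f≺g  = λ a c → f≺g c a
    ; g⊀f  = λ a c → g⊀f c a
    }
    where open TotalCut cut

  totalCut-resp-≋ : {T T′ : Rel p} → TotalCut f g U V T → T ≋ T′ → TotalCut f g U V T′
  totalCut-resp-≋ cut T≋T′ = record
    { on-f = λ a c → trans (sym (T≋T′ _ _)) (on-f a c)
    ; on-g = λ a c → trans (sym (T≋T′ _ _)) (on-g a c)
    ; f≺g  = λ a c → trans (sym (T≋T′ _ _)) (f≺g a c)
    ; g⊀f  = λ a c → trans (sym (T≋T′ _ _)) (g⊀f a c)
    }
    where open TotalCut cut

  totalCut-resp-≗ : {f′ : Fin m → Fin p} {g′ : Fin n → Fin p} {T : Rel p} →
                    TotalCut f g U V T → (∀ a → f a ≡ f′ a) → (∀ b → g b ≡ g′ b) →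
                    TotalCut f′ g′ U V T
  totalCut-resp-≗ {T = T} cut f≗f′ g≗g′ = record
    { on-f = λ a c → trans (cong₂ T (sym (f≗f′ a)) (sym (f≗f′ c))) (on-f a c)
    ; on-g = λ a c → trans (cong₂ T (sym (g≗g′ a)) (sym (g≗g′ c))) (on-g a c)
    ; f≺g  = λ a c → trans (cong₂ T (sym (f≗f′ a)) (sym (g≗g′ c))) (f≺g a c)
    ; g⊀f  = λ a c → trans (cong₂ T (sym (g≗g′ c)) (sym (f≗f′ a))) (g⊀f a c)
    }
    where open TotalCut cut

  module _ (cover : ∀ z → Img f z ⊎ Img g z) where

    totalCut-≋ : {T T′ : Rel p} → TotalCut f g U V T → TotalCut f g U V T′ → T ≋ T′
    totalCut-≋ cut cut′ u v with cover u | cover v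
    ... | inj₁ (a , refl) | inj₁ (c , refl) = trans (TotalCut.on-f cut a c) (sym (TotalCut.on-f cut′ a c))
    ... | inj₁ (a , refl) | inj₂ (d , refl) = trans (TotalCut.f≺g cut a d) (sym (TotalCut.f≺g cut′ a d))
    ... | inj₂ (b , refl) | inj₁ (c , refl) = trans (TotalCut.g⊀f cut c b) (sym (TotalCut.g⊀f cut′ c b))
    ... | inj₂ (b , refl) | inj₂ (d , refl) = trans (TotalCut.on-g cut b d) (sym (TotalCut.on-g cut′ b d))

    IsPoset-totalCut : {T : Rel p} → TotalCut f g U V T → IsPoset U → IsPoset V → IsPoset T
    IsPoset-totalCut {T} cut U-poset V-poset = mkIsPoset reflexive antisymmetric transitive
      where
      open TotalCut cut
      module U = IsPartialOrder U-poset
      module V = IsPartialOrder V-poset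
      reflexive : ∀ u → T u u ≡ true
      reflexive u with cover u
      ... | inj₁ (a , refl) = trans (on-f a a) U.refl
      ... | inj₂ (b , refl) = trans (on-g b b) V.refl
      antisymmetric : ∀ {u v} → T u v ≡ true → T v u ≡ true → u ≡ v
      antisymmetric {u} {v} Tuv Tvu with cover u | cover v
      ... | inj₁ (a , refl) | inj₁ (c , refl) =
        cong f (U.antisym (trans (sym (on-f a c)) Tuv) (trans (sym (on-f c a)) Tvu))
      ... | inj₁ (a , refl) | inj₂ (d , refl) = ⊥-elim (true≢false Tvu (g⊀f a d))
      ... | inj₂ (b , refl) | inj₁ (c , refl) = ⊥-elim (true≢false Tuv (g⊀f c b))
      ... | inj₂ (b , refl) | inj₂ (d , refl) =
        cong g (V.antisym (trans (sym (on-g b d)) Tuv) (trans (sym (on-g d b)) Tvu))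
      transitive : ∀ {u v w} → T u v ≡ true → T v w ≡ true → T u w ≡ true
      transitive {u} {v} {w} Tuv Tvw with cover u | cover v | cover w
      ... | inj₁ (a , refl) | inj₁ (b , refl) | inj₁ (c , refl) =
        trans (on-f a c) (U.trans (trans (sym (on-f a b)) Tuv) (trans (sym (on-f b c)) Tvw))
      ... | inj₁ (a , refl) | _               | inj₂ (c , refl) = f≺g a c
      ... | _               | inj₂ (b , refl) | inj₁ (c , refl) = ⊥-elim (true≢false Tvw (g⊀f c b))
      ... | inj₂ (a , refl) | inj₁ (b , refl) | _               = ⊥-elim (true≢false Tuv (g⊀f b a))
      ... | inj₂ (a , refl) | inj₂ (b , refl) | inj₂ (c , refl) =
        trans (on-g a c) (V.trans (trans (sym (on-g a b)) Tuv) (trans (sym (on-g b c)) Tvw))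

    module _ {T : Rel p} (cut : TotalCut f g U V T) where
      open TotalCut cut

      first-block-closed : ∀ {i z} → T (f i) z ≡ false → Img f z
      first-block-closed {i} {z} ¬Tfiz with cover z
      ... | inj₁ z∈X       = z∈X
      ... | inj₂ (c , refl) = ⊥-elim (true≢false (f≺g i c) ¬Tfiz)

      no-chain-from-first-to-second : ∀ {u v} → Chain T u v → Img f u → Img g v → ⊥
      no-chain-from-first-to-second [ _ , ¬Tuv ]       (a , refl) (c , refl) = true≢false (f≺g a c) ¬Tuv
      no-chain-from-first-to-second ((_ , ¬Tuz) ∷ z⋯v) (a , refl) v∈Y =
        no-chain-from-first-to-second z⋯v (first-block-closed ¬Tuz) v∈Y

      second-block-closed : ChainClosed g T
      second-block-closed {c = c} {z} _ z⋯gc with cover z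
      ... | inj₂ z∈Y = z∈Y
      ... | inj₁ z∈X = ⊥-elim (no-chain-from-first-to-second z⋯gc z∈X (c , refl))

      not-removed-across : ∀ a c → removedI T (f a) (g c) ≡ false
      not-removed-across a c with removedI T (f a) (g c) in e
      ... | false = refl
      ... | true  = ⊥-elim (no-chain-from-first-to-second (removed⇒chain (removedI⁻ T e)) (a , refl) (c , refl))

module _ {f f′ : Fin m → Fin p} {g g′ : Fin n → Fin p} {U U′ : Rel m} {V V′ : Rel n} {γ : Rel p}
         (split : Splitting f g) (split′ : Splitting f′ g′)
         (cut : TotalCut f g U V γ) (cut′ : TotalCut f′ g′ U′ V′ γ) where
  private
    module S  = Splitting split
    module S′ = Splitting split′

  -- A point of X outside X′ lies in Y′, so no point of X′ can lie in Y.
  first-blocks-nested : ∀ a → ¬ Img f′ (f a) → ∀ a′ → Img f (f′ a′)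
  first-blocks-nested a fa∉X′ a′ with S′.cover (f a) | S.cover (f′ a′)
  ... | inj₁ fa∈X′        | _                  = ⊥-elim (fa∉X′ fa∈X′)
  ... | inj₂ _            | inj₁ f′a′∈X        = f′a′∈X
  ... | inj₂ (c , g′c≡fa) | inj₂ (d , gd≡f′a′) =
    ⊥-elim (true≢false (subst (λ v → γ (f a) v ≡ true) gd≡f′a′ (TotalCut.f≺g cut a d))
                       (subst (λ u → γ u (f′ a′) ≡ false) g′c≡fa (TotalCut.g⊀f cut′ a′ c)))

  totalCut-blocks-unique : (∀ a → f a ≡ f′ a) × (∀ b → g b ≡ g′ b)
  totalCut-blocks-unique = f≗f′ , increasing-⊆⇒≗ S.g-increasing S′.g-increasing Y⊆Y′
    where
    f≗f′ : ∀ a → f a ≡ f′ a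
    f≗f′ with all? (λ a → any? (λ a′ → f′ a′ ≟ f a))
    ... | yes X⊆X′ = increasing-⊆⇒≗ S.f-increasing S′.f-increasing X⊆X′
    ... | no  X⊈X′ with a , fa∉X′ ← ¬∀⟶∃¬ m _ (λ a → any? (λ a′ → f′ a′ ≟ f a)) X⊈X′ =
      λ a″ → sym (increasing-⊆⇒≗ S′.f-increasing S.f-increasing (first-blocks-nested a fa∉X′) a″)
    Y⊆Y′ : ∀ b → Img g′ (g b)
    Y⊆Y′ b with S′.cover (g b)
    ... | inj₂ gb∈Y′        = gb∈Y′
    ... | inj₁ (a , f′a≡gb) = ⊥-elim (S.disjoint a b (trans (f≗f′ a) f′a≡gb))

module _ {f : Fin m → Fin p} {g : Fin n → Fin p} (split : Splitting f g) (R : Rel m) (S : Rel n) where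
  private
    module S = Splitting split

    side : Fin p → Fin m ⊎ Fin n
    side z = [ inj₁ ∘ proj₁ , inj₂ ∘ proj₁ ]′ (S.cover z)

    side-f : ∀ a → side (f a) ≡ inj₁ a
    side-f a with S.cover (f a)
    ... | inj₁ (a′ , fa′≡fa) = cong inj₁ (increasing-injective S.f-increasing fa′≡fa)
    ... | inj₂ (b , gb≡fa)   = ⊥-elim (S.disjoint a b (sym gb≡fa))

    side-g : ∀ b → side (g b) ≡ inj₂ b
    side-g b with S.cover (g b)
    ... | inj₁ (a , fa≡gb)   = ⊥-elim (S.disjoint a b fa≡gb)
    ... | inj₂ (b′ , gb′≡gb) = cong inj₂ (increasing-injective S.g-increasing gb′≡gb)

    block : Fin m ⊎ Fin n → Fin m ⊎ Fin n → Bool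
    block (inj₁ a) (inj₁ c) = R a c
    block (inj₁ _) (inj₂ _) = true
    block (inj₂ _) (inj₁ _) = false
    block (inj₂ b) (inj₂ d) = S b d

  -- Opaque: unfolding glue during unification evaluates the cover of a witness, which is very costly.
  opaque
    glue : Rel p
    glue u v = block (side u) (side v)

    glue-totalCut : TotalCut f g R S glue
    glue-totalCut = record
      { on-f = λ a c → cong₂ block (side-f a) (side-f c)
      ; on-g = λ b d → cong₂ block (side-g b) (side-g d)
      ; f≺g  = λ a d → cong₂ block (side-f a) (side-g d)
      ; g⊀f  = λ a d → cong₂ block (side-g d) (side-f a)
      }

increasing⁻ : {φ : Fin k → Fin p} → increasing φ ≡ true → Increasing φ
increasing⁻ e {i} {j} i<j = <ᵇ⁻ (⇒ᵇ⁻ (∀ᵇ⁻ (∀ᵇ⁻ e i) j) (<ᵇ⁺ i<j))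

increasing⁺ : {φ : Fin k → Fin p} → Increasing φ → increasing φ ≡ true
increasing⁺ {φ = φ} φ-increasing = ∀ᵇ⁺ λ i → ∀ᵇ⁺ λ j →
  ⇒ᵇ⁺ {i <ᵇ j} {φ i <ᵇ φ j} λ i<j → <ᵇ⁺ (φ-increasing (<ᵇ⁻ i<j))

record StarWitness (R : Rel m) (S : Rel n) (T : Rel (m + n)) : Set where
  field
    f         : Fin m → Fin (m + n)
    g         : Fin n → Fin (m + n)
    f-listed  : f ∈ allFuns m (allFin (m + n))
    g-listed  : g ∈ allFuns n (allFin (m + n))
    splitting : Splitting f g
    cut       : TotalCut f g R S T

inStar⁻ : (R : Rel m) (S : Rel n) (T : Rel (m + n)) → inStar R S T ≡ true → StarWitness R S T
inStar⁻ {m} {n} R S T e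
  with f , f-listed , e₁ ← any⁻-∈ (allFuns m (allFin (m + n))) e
  with g , g-listed , e₂ ← any⁻-∈ (allFuns n (allFin (m + n))) e₁
  with f-inc , e₃ ← ∧⁻ {increasing f} e₂
  with g-inc , e₄ ← ∧⁻ {increasing g} e₃
  with disj , e₅ ← ∧⁻ {∀ᵇ λ i → ∀ᵇ λ j → not (f i ≟ᵇ g j)} e₄
  with cut , e₆ ← ∧⁻ {∀ᵇ λ i → ∀ᵇ λ j → T (f i) (g j) ∧ not (T (g j) (f i))} e₅
  with on-f , on-g ← ∧⁻ {(T on f) ≐ᵇ R} e₆ = record
    { f = f ; g = g ; f-listed = f-listed ; g-listed = g-listed
    ; splitting = record
      { f-increasing = increasing⁻ f-inc
      ; g-increasing = increasing⁻ g-inc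
      ; disjoint     = disjoint
      ; cover        = disjoint⇒cover (increasing⁻ f-inc) (increasing⁻ g-inc) disjoint
      }
    ; cut = record
      { on-f = ≐ᵇ⁻ on-f
      ; on-g = ≐ᵇ⁻ on-g
      ; f≺g  = λ a c → proj₁ (cut-at a c)
      ; g⊀f  = λ a c → not⁻ (proj₂ (cut-at a c))
      }
    }
  where
  disjoint : ∀ i j → f i ≢ g j
  disjoint i j fi≡gj = true≢false (≟ᵇ⁺ fi≡gj) (not⁻ (∀ᵇ⁻ (∀ᵇ⁻ disj i) j))
  cut-at : ∀ a c → T (f a) (g c) ≡ true × not (T (g c) (f a)) ≡ true
  cut-at a c = ∧⁻ (∀ᵇ⁻ (∀ᵇ⁻ cut a) c)

inStar⁺ : {R : Rel m} {S : Rel n} {T : Rel (m + n)} {f : Fin m → Fin (m + n)} {g : Fin n → Fin (m + n)} →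
          f ∈ allFuns m (allFin (m + n)) → g ∈ allFuns n (allFin (m + n)) →
          Splitting f g → TotalCut f g R S T → inStar R S T ≡ true
inStar⁺ f-listed g-listed split cut = any⁺-∈ f-listed (any⁺-∈ g-listed
  (∧⁺ (increasing⁺ f-increasing) (∧⁺ (increasing⁺ g-increasing)
  (∧⁺ (∀ᵇ⁺ λ i → ∀ᵇ⁺ λ j → not⁺ (≟ᵇ-≢ (disjoint i j)))
  (∧⁺ (∀ᵇ⁺ λ i → ∀ᵇ⁺ λ j → ∧⁺ (f≺g i j) (not⁺ (g⊀f i j)))
  (∧⁺ (≐ᵇ⁺ on-f) (≐ᵇ⁺ on-g)))))))
  where
  open Splitting split
  open TotalCut cut

chainᵏ-cong : {R R′ : Rel p} → R ≋ R′ → ∀ k x y → chainᵏ R k x y ≡ chainᵏ R′ k x y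
chainᵏ-cong R≋R′ zero    x y = cong (λ r → (x <ᵇ y) ∧ not r) (R≋R′ x y)
chainᵏ-cong R≋R′ (suc k) x y = cong₂ _∨_ (cong (λ r → (x <ᵇ y) ∧ not r) (R≋R′ x y))
  (∃ᵇ-cong λ z → cong₂ (λ r c → (x <ᵇ z) ∧ not r ∧ c) (R≋R′ x z) (chainᵏ-cong R≋R′ k z y))

removedI-cong : {R R′ : Rel p} → R ≋ R′ → ∀ a c → removedI R a c ≡ removedI R′ a c
removedI-cong {p} R≋R′ a c = cong ((a <ᵇ c) ∧_)
  (∃ᵇ-cong λ b → cong₂ (λ r ch → (a <ᵇ b) ∧ not r ∧ ch) (R≋R′ a b) (chainᵏ-cong R≋R′ p b c))

dI-cong : {R R′ : Rel p} → R ≋ R′ → dI R ≋ dI R′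
dI-cong R≋R′ i j = cong₂ (λ r rem → r ∧ not rem) (R≋R′ i j) (removedI-cong R≋R′ i j)

dI-totalCut : {f : Fin m → Fin p} {g : Fin n → Fin p} {U : Rel m} {V : Rel n} {T : Rel p} →
              Splitting f g → TotalCut f g U V T → TotalCut f g (dI U) (dI V) (dI T)
dI-totalCut {T = T} split cut = record
  { on-f = ≋-trans (≋-sym (dI-on f-increasing first-closed)) (dI-cong on-f)
  ; on-g = ≋-trans (≋-sym (dI-on g-increasing (second-block-closed cover cut))) (dI-cong on-g)
  ; f≺g  = λ a c → cong₂ (λ r rem → r ∧ not rem) (f≺g a c) (not-removed-across cover cut a c)
  ; g⊀f  = λ a c → cong (_∧ not (removedI T _ _)) (g⊀f a c)
  }
  where
  open Splitting split
  open TotalCut cut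
  first-closed : ChainClosed _ T
  first-closed (_ , ¬Tfiz) _ = first-block-closed cover cut ¬Tfiz

record Compatible (proj : ∀ {k} → Rel k → Rel k) : Set where
  field
    cong-≋    : {R R′ : Rel k} → R ≋ R′ → proj R ≋ proj R′
    on-convex : {φ : Fin k → Fin p} {T : Rel p} → Increasing φ → Convex φ → proj (T on φ) ≋ (proj T on φ)
    totalCut  : {f : Fin m → Fin p} {g : Fin n → Fin p} {U : Rel m} {V : Rel n} {T : Rel p} →
                Splitting f g → TotalCut f g U V T → TotalCut f g (proj U) (proj V) (proj T)

dI-compatible : Compatible dI
dI-compatible = record
  { cong-≋    = dI-cong
  ; on-convex = λ φ-increasing convex → dI-on φ-increasing (convex⇒chainClosed convex)
  ; totalCut  = dI-totalCut
  }

transpose-compatible : {proj : ∀ {k} → Rel k → Rel k} → Compatible proj →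
                       Compatible (λ R → transpose (proj (transpose R)))
transpose-compatible compatible = record
  { cong-≋    = λ R≋R′ i j → cong-≋ (λ a b → R≋R′ b a) j i
  ; on-convex = λ φ-increasing convex i j → on-convex φ-increasing convex j i
  ; totalCut  = λ split cut → totalCut-transpose (totalCut (splitting-swap split) (totalCut-transpose cut))
  }
  where open Compatible compatible

∘-compatible : {proj proj′ : ∀ {k} → Rel k → Rel k} → Compatible proj → Compatible proj′ →
               Compatible (λ R → proj (proj′ R))
∘-compatible compatible compatible′ = record
  { cong-≋    = P.cong-≋ ∘ P′.cong-≋
  ; on-convex = λ φ-increasing convex →
      ≋-trans (P.cong-≋ (P′.on-convex φ-increasing convex)) (P.on-convex φ-increasing convex)
  ; totalCut  = λ split → P.totalCut split ∘ P′.totalCut split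
  }
  where
  module P  = Compatible compatible
  module P′ = Compatible compatible′

-- dD R i j and transpose (dI (transpose R)) i j have the same normal form.
dD-compatible : Compatible dD
dD-compatible = transpose-compatible dI-compatible

d-compatible : Compatible d
d-compatible = ∘-compatible dI-compatible dD-compatible

module _ {proj : ∀ {k} → Rel k → Rel k} (compatible : Compatible proj) where
  open Compatible compatible

  prodCoef-poset : (a : Rel m) (b : Rel n) (T : Rel (m + n)) → isPoset T ≡ true →
                   prodCoef proj a b T ≡
                   (if ((proj T on (_↑ˡ n)) ≐ᵇ a) ∧ ((proj T on (m ↑ʳ_)) ≐ᵇ b) then 1 else 0)
  prodCoef-poset {m} {n} a b T T-poset =
    count-singleton shuffled _ coefficient (pairs (allRel m) (allRel n))
      (λ x → shuffled-coefficient (proj₁ x) (proj₂ x)) shuffled-once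
    where
    open ≡-Reasoning
    shuffled : Rel m × Rel n → Bool
    shuffled x = inShuffle (proj₁ x) (proj₂ x) T
    shuffled-once : count shuffled (pairs (allRel m) (allRel n)) ≡ 1
    shuffled-once = pairs-enumerates {_≈₁_ = _≐ᵇ_} {_≈₂_ = _≐ᵇ_} {allRel m} {allRel n}
                      (allRel-enumerates m) (allRel-enumerates n) ((T on (_↑ˡ n)) , (T on (m ↑ʳ_)))
    block-poset : ∀ {k} {φ : Fin k → Fin (m + n)} {P : Rel k} →
                  Increasing φ → P ≋ (T on φ) → isPoset P ≡ true
    block-poset φ-increasing P≋ =
      trans (isPoset-cong P≋) (isPoset⁺ (IsPoset-on {T = T} (increasing-injective φ-increasing) (isPoset⁻ T-poset)))
    block-proj : ∀ {k} {φ : Fin k → Fin (m + n)} {P : Rel k} (c : Rel k) → Increasing φ → Convex φ →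
                 P ≋ (T on φ) → (proj P ≐ᵇ c) ≡ ((proj T on φ) ≐ᵇ c)
    block-proj c φ-increasing φ-convex P≋ =
      ≐ᵇ-congˡ c (≋-trans (cong-≋ P≋) (on-convex φ-increasing φ-convex))
    left-ok  = (proj T on (_↑ˡ n)) ≐ᵇ a
    right-ok = (proj T on (m ↑ʳ_)) ≐ᵇ b
    coefficient = left-ok ∧ right-ok
    shuffled-coefficient : ∀ P Q →
      (isPoset P ∧ (proj P ≐ᵇ a) ∧ isPoset Q ∧ (proj Q ≐ᵇ b) ∧ isPoset T ∧ inShuffle P Q T) ≡
      coefficient ∧ inShuffle P Q T
    shuffled-coefficient P Q with inShuffle P Q T in P,Q↦T
    ... | false rewrite ∧-zeroʳ (isPoset T) | ∧-zeroʳ (proj Q ≐ᵇ b) | ∧-zeroʳ (isPoset Q)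
                      | ∧-zeroʳ (proj P ≐ᵇ a) | ∧-zeroʳ (isPoset P) = sym (∧-zeroʳ coefficient)
    ... | true = begin
      isPoset P ∧ (proj P ≐ᵇ a) ∧ isPoset Q ∧ (proj Q ≐ᵇ b) ∧ isPoset T ∧ true
        ≡⟨ cong₂ _∧_ (block-poset ↑ˡ-increasing P≋)
           (cong₂ _∧_ (block-proj a ↑ˡ-increasing ↑ˡ-convex P≋)
           (cong₂ _∧_ (block-poset ↑ʳ-increasing Q≋)
           (cong₂ _∧_ (block-proj b ↑ʳ-increasing ↑ʳ-convex Q≋)
           (cong (_∧ true) T-poset)))) ⟩
      left-ok ∧ right-ok ∧ true
        ≡⟨ ∧-assoc left-ok right-ok true ⟨
      coefficient ∧ true ∎
      where
      P≋ : P ≋ (T on (_↑ˡ n))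
      P≋ = ≋-sym (≐ᵇ⁻ (proj₁ (∧⁻ P,Q↦T)))
      Q≋ : Q ≋ (T on (m ↑ʳ_))
      Q≋ = ≋-sym (≐ᵇ⁻ (proj₂ (∧⁻ {(T on (_↑ˡ n)) ≐ᵇ P} P,Q↦T)))

  counted : Rel (m + n) → Rel m → Rel n → Rel (m + n) → Bool
  counted γ R S T = isPoset T ∧ (proj T ≐ᵇ γ) ∧ inStar R S T

  projected-star : {γ : Rel (m + n)} {R : Rel m} {S : Rel n} {T : Rel (m + n)} → counted γ R S T ≡ true →
                   Σ (StarWitness R S T) λ w → TotalCut (StarWitness.f w) (StarWitness.g w) (proj R) (proj S) γ
  projected-star {γ = γ} {R} {S} {T} e
    with _ , e′ ← ∧⁻ {isPoset T} e
    with proj-T≐γ , T∈R⋆S ← ∧⁻ {proj T ≐ᵇ γ} e′ =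
    w , totalCut-resp-≋ (totalCut splitting (StarWitness.cut w)) (≐ᵇ⁻ proj-T≐γ)
    where
    w = inStar⁻ R S T T∈R⋆S
    open StarWitness w using (splitting)

  coprodCoef-∉ : (γ : Rel (m + n)) (R : Rel m) (S : Rel n) → inStar (proj R) (proj S) γ ≡ false →
                 coprodCoef proj γ R S ≡ 0
  coprodCoef-∉ {m} {n} γ R S γ∉ = count-false not-counted (allRel (m + n))
    where
    not-counted : ∀ T → counted γ R S T ≡ false
    not-counted T = ¬-not λ e →
      let w , γ-cut = projected-star e
          open StarWitness w
      in true≢false (inStar⁺ {R = proj R} {proj S} {γ} f-listed g-listed splitting γ-cut) γ∉

  -- T is counted iff it has the total cut of γ with blocks R and S, i.e. iff it is the glued relation.
  coprodCoef-∈ : (γ : Rel (m + n)) (R : Rel m) (S : Rel n) → isPoset R ≡ true → isPoset S ≡ true →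
                 inStar (proj R) (proj S) γ ≡ true → coprodCoef proj γ R S ≡ 1
  coprodCoef-∈ {m} {n} γ R S R-poset S-poset γ∈ =
    count-singleton (glued ≐ᵇ_) (counted γ R S) true (allRel (m + n)) counted≡glued (allRel-enumerates (m + n) glued)
    where
    w = inStar⁻ (proj R) (proj S) γ γ∈
    open StarWitness w
    open Splitting splitting using (cover)
    glued = glue splitting R S
    counted≡glued : ∀ T → counted γ R S T ≡ (glued ≐ᵇ T)
    counted≡glued T = true-iff⇒≡ counted⇒glued glued⇒counted
      where
      counted⇒glued : counted γ R S T ≡ true → (glued ≐ᵇ T) ≡ true
      counted⇒glued e =
        let w′ , cut′ = projected-star e
            f≗f′ , g≗g′ = totalCut-blocks-unique splitting (StarWitness.splitting w′) cut cut′
            T-cut = totalCut-resp-≗ (StarWitness.cut w′) (λ a → sym (f≗f′ a)) (λ b → sym (g≗g′ b))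
        in ≐ᵇ⁺ (totalCut-≋ cover (glue-totalCut splitting R S) T-cut)
      glued⇒counted : (glued ≐ᵇ T) ≡ true → counted γ R S T ≡ true
      glued⇒counted e = ∧⁺ T-poset (∧⁺ proj-T≐γ T∈R⋆S)
        where
        T-cut : TotalCut f g R S T
        T-cut = totalCut-resp-≋ (glue-totalCut splitting R S) (≐ᵇ⁻ e)
        T-poset : isPoset T ≡ true
        T-poset = isPoset⁺ (IsPoset-totalCut cover T-cut (isPoset⁻ R-poset) (isPoset⁻ S-poset))
        proj-T≐γ : (proj T ≐ᵇ γ) ≡ true
        proj-T≐γ = ≐ᵇ⁺ (totalCut-≋ cover (totalCut splitting T-cut) cut)
        T∈R⋆S : inStar R S T ≡ true
        T∈R⋆S = inStar⁺ f-listed g-listed splitting T-cut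

  coprodCoef-poset : (γ : Rel (m + n)) (R : Rel m) (S : Rel n) → isPoset R ≡ true → isPoset S ≡ true →
                     coprodCoef proj γ R S ≡ (if inStar (proj R) (proj S) γ then 1 else 0)
  coprodCoef-poset γ R S R-poset S-poset with inStar (proj R) (proj S) γ in γ∈?
  ... | false = coprodCoef-∉ γ R S γ∈?
  ... | true  = coprodCoef-∈ γ R S R-poset S-poset γ∈?

module _ {c ℓ} (K : Field c ℓ) {proj : ∀ {k} → Rel k → Rel k} (compatible : Compatible proj) where
  open Field K using (reflexive)

  stable : (isClass : ∀ {k} → Rel k → Bool) → ProductStable K isClass proj × CoproductStable K isClass proj
  stable isClass =
    (λ m n a b _ _ →
      (λ U → fromℕ K (if ((U on (_↑ˡ n)) ≐ᵇ a) ∧ ((U on (m ↑ʳ_)) ≐ᵇ b) then 1 else 0)) ,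
      λ T T-poset → reflexive (cong (fromℕ K) (prodCoef-poset compatible a b T T-poset))) ,
    (λ m n γ _ →
      (λ U V → fromℕ K (if inStar U V γ then 1 else 0)) ,
      λ R S R-poset S-poset → reflexive (cong (fromℕ K) (coprodCoef-poset compatible γ R S R-poset S-poset)))

mainTheorem16 : ∀ {c ℓ : Level} (K : Field c ℓ) →
    (ProductStable K isWOIP d × CoproductStable K isWOIP d) ×
    (ProductStable K isIWOIP dI × CoproductStable K isIWOIP dI) ×
    (ProductStable K isDWOIP dD × CoproductStable K isDWOIP dD)
mainTheorem16 K = stable K d-compatible isWOIP , stable K dI-compatible isIWOIP , stable K dD-compatible isDWOIP
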